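{- Let $q$ be a prime power. For each integer $t\ge 2$ we have $n_q(2t,4,2)\le 3t+3$ and $n_2(2t+1,4,2)\le 3t+5$.
   Context: An $[n,k,d]_q$-code is a $k$-dimensional subspace of $\mathbb{F}_q^n$ with minimum Hamming distance at least $d$. A linear code $C\subseteq\mathbb{F}_q^n$ has locality $r$ if for every coordinate $i$ there is a set $S_i\subseteq\{1,\dots,n\}\setminus\{i\}$ with $|S_i|\le r$ such that any two codewords agreeing on all coordinates in $S_i$ also agree in coordinate $i$. $n_q(k,d,r)$ denotes the minimum length $n$ of an $[n,k,d]_q$-code with locality $r$. -}

module Defs where

open import Level using (0ℓ)
open import Data.Nat using (ℕ; zero; suc; _≤_)
import Data.Fin as Fin
open Fin using (Fin)
open import Data.Fin.Subset using (Subset; _∈_; _∉_; ∣_∣)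
open import Data.Product using (Σ; ∃; _×_; _,_)
open import Data.Empty using (⊥)
open import Relation.Nullary using (¬_; Dec; yes; no)
open import Relation.Binary.PropositionalEquality using (_≡_)
open import Algebra.Structures using (IsCommutativeRing)
open import Function.Bundles using (_↔_)

record FiniteField : Set₁ where
  field
    Carrier : Set
    _+_ _*_ : Carrier → Carrier → Carrier
    -_ : Carrier → Carrier
    0# 1# : Carrier
    isCommutativeRing : IsCommutativeRing _≡_ _+_ _*_ -_ 0# 1#
    0≢1 : ¬ (0# ≡ 1#)
    inverse : (x : Carrier) → ¬ (x ≡ 0#) → Σ Carrier (λ y → x * y ≡ 1#)
    _≟_ : (x y : Carrier) → Dec (x ≡ y)
    size : ℕ
    enumeration : Fin size ↔ Carrier

module _ (F : FiniteField) where
  open FiniteField F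

  Word : ℕ → Set
  Word n = Fin n → Carrier

  sumF : (k : ℕ) → (Fin k → Carrier) → Carrier
  sumF zero f = 0#
  sumF (suc k) f = f Fin.zero + sumF k (λ i → f (Fin.suc i))

  encode : {k n : ℕ} → (Fin k → Fin n → Carrier) → Word k → Word n
  encode {k} G m j = sumF k (λ i → m i * G i j)

  dist : (n : ℕ) → Word n → Word n → ℕ
  dist zero c c' = 0
  dist (suc n) c c' with c Fin.zero ≟ c' Fin.zero
  ... | yes _ = dist n (λ j → c (Fin.suc j)) (λ j → c' (Fin.suc j))
  ... | no  _ = suc (dist n (λ j → c (Fin.suc j)) (λ j → c' (Fin.suc j)))

  -- The code C ⊆ F^n is the row space of G : Fin k → Fin n → F,
  -- i.e. the image of the linear map m ↦ m·G.
  -- C is k-dimensional: the rows of G are linearly independent.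
  IsFullRank : {k n : ℕ} → (Fin k → Fin n → Carrier) → Set
  IsFullRank {k} {n} G = (m : Word k) → (∀ j → encode G m j ≡ 0#) → ∀ i → m i ≡ 0#

  MinDistAtLeast : {k n : ℕ} → (Fin k → Fin n → Carrier) → ℕ → Set
  MinDistAtLeast {k} {n} G d = (m m' : Word k) →
    (∃ λ j → ¬ (encode G m j ≡ encode G m' j)) → d ≤ dist n (encode G m) (encode G m')

  HasLocality : {k n : ℕ} → (Fin k → Fin n → Carrier) → ℕ → Set
  HasLocality {k} {n} G r = (i : Fin n) → Σ (Subset n) λ S →
    (i ∉ S) × (∣ S ∣ ≤ r) ×
    ((m m' : Word k) → (∀ j → j ∈ S → encode G m j ≡ encode G m' j) → encode G m i ≡ encode G m' i)

  IsLRC : (n k d r : ℕ) → (Fin k → Fin n → Carrier) → Set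
  IsLRC n k d r G = IsFullRank G × MinDistAtLeast G d × HasLocality G r

  -- n_q(k,d,r) ≤ N : some [n,k,d]_q code with locality r has length n ≤ N
  nLRC≤ : (k d r N : ℕ) → Set
  nLRC≤ k d r N = Σ ℕ λ n → (n ≤ N) × Σ (Fin k → Fin n → Carrier) (IsLRC n k d r)

{-# OPTIONS --safe #-}
module Submission where

-- Write P(x , y) = (x , y , x + y) for the [3,2,2] parity-check code. The code of dimension 2t
-- consists of the words P(p₁) ++ … ++ P(pₜ₊₁) whose information pairs pᵢ ∈ F² sum to 0; for
-- dimension 2t + 1 an extra symbol c is appended twice and the pairs must sum to −(c , 0) instead.
-- Each symbol is recovered from the other two of its parity block, or from its copy, so the
-- locality is 2. A nonzero parity block has weight at least 2. A nonzero codeword with c = 0 cannot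
-- have exactly one nonzero block because of the sum condition, so its weight is at least 4; if
-- c ≠ 0 the pairs have nonzero sum, so some block is nonzero, and the two copies of c add 2.
-- The codes are built one block at a time, prescribing the sum s of the remaining pairs; the bound
-- carried through the induction is wt (P s) + wt (codeword) ≥ 4.

open import Defs
open import Data.Nat using (ℕ; _≤_; _+_; _*_)
open import Data.Product using (_×_)
open import Relation.Binary.PropositionalEquality using (_≡_)

open import Level using (0ℓ)
open import Function using (_∘_; id)
open import Algebra.Bundles using (CommutativeRing)
open import Data.Nat using (zero; suc; z≤n; s≤s)
import Data.Nat.Properties as ℕ
open import Data.Fin using (Fin; zero; suc; splitAt; _↑ˡ_; _↑ʳ_)
open import Data.Fin.Patterns using (0F; 1F; 2F; 3F)
open import Data.Fin.Subset using (Subset; _∈_; _∉_; ∣_∣; ⊥; inside; outside)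
open import Data.Fin.Subset.Properties using (∣⊥∣≡0)
open import Data.Vec using (_∷_; []; here; there)
open import Data.Vec.Functional using (_++_; take; drop)
open import Data.Product using (Σ; _,_)
open import Data.Sum using (_⊎_; inj₁; inj₂)
open import Data.Sum.Properties using ([,]-map)
open import Data.Empty using (⊥-elim)
open import Relation.Nullary using (yes; no)
open import Relation.Nullary.Decidable using (toSum)
open import Relation.Binary.PropositionalEquality
  using (_≢_; _≗_; refl; sym; trans; cong; cong₂; subst; subst₂; module ≡-Reasoning)
open import Algebra.Properties.CommutativeSemigroup ℕ.+-commutativeSemigroup
  using () renaming (interchange to +-interchange)

module _ (F : FiniteField) where
  open FiniteField F using (Carrier; 0#; 1#; _≟_; isCommutativeRing)

  R : CommutativeRing 0ℓ 0ℓ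
  R = record { isCommutativeRing = isCommutativeRing }

  open CommutativeRing R
    using (+-assoc; +-identityˡ; +-identityʳ; *-identityʳ; zeroˡ; zeroʳ; distribˡ;
           ring; +-commutativeSemigroup)
    renaming (_+_ to _⊕_; _*_ to _⊗_; _-_ to _⊖_)
  open import Algebra.Properties.Ring ring
    using (x∙y⁻¹≈ε⇒x≈y; x≈y⇒x∙y⁻¹≈ε; x≈z//y; //-rightDividesˡ; +-cancelˡ; +-cancelʳ;
           -‿+-comm; ⁻¹-anti-homo‿-; xyx⁻¹≈y; x[y-z]≈xy-xz; -0#≈0#)
  open import Algebra.Properties.CommutativeSemigroup +-commutativeSemigroup
    using () renaming (interchange to ⊕-interchange)

  ⊕-⊖-interchange : ∀ x y a b → (x ⊕ y) ⊖ (a ⊕ b) ≡ (x ⊖ a) ⊕ (y ⊖ b)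
  ⊕-⊖-interchange x y a b = trans (cong ((x ⊕ y) ⊕_) (sym (-‿+-comm a b))) (⊕-interchange x y _ _)

  x⊖[x⊖y]≡y : ∀ x y → x ⊖ (x ⊖ y) ≡ y
  x⊖[x⊖y]≡y x y =
    trans (cong (x ⊕_) (⁻¹-anti-homo‿- x y)) (trans (sym (+-assoc x y _)) (xyx⁻¹≈y x y))

  x⊖0≡x : ∀ x → x ⊖ 0# ≡ x
  x⊖0≡x x = trans (cong (x ⊕_) -0#≈0#) (+-identityʳ x)

  -- Linear maps and generator matrices

  0ᵥ : ∀ {n} → Word F n
  0ᵥ _ = 0#

  _⊕ᵥ_ _⊖ᵥ_ : ∀ {n} → Word F n → Word F n → Word F n
  (u ⊕ᵥ v) i = u i ⊕ v i
  (u ⊖ᵥ v) i = u i ⊖ v i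

  _⊗ᵥ_ : ∀ {n} → Carrier → Word F n → Word F n
  (a ⊗ᵥ u) i = a ⊗ u i

  record IsLinear {k n : ℕ} (f : Word F k → Word F n) : Set where
    field
      cong-≗ : ∀ {u v} → u ≗ v → f u ≗ f v
      additive : ∀ u v → f (u ⊕ᵥ v) ≗ f u ⊕ᵥ f v
      homogeneous : ∀ a u → f (a ⊗ᵥ u) ≗ a ⊗ᵥ f u

  open IsLinear

  reindex-isLinear : ∀ {k n} (ρ : Fin n → Fin k) → IsLinear (λ (u : Word F k) → u ∘ ρ)
  reindex-isLinear ρ = record
    { cong-≗ = λ u≗v → u≗v ∘ ρ ; additive = λ _ _ _ → refl ; homogeneous = λ _ _ _ → refl }

  zero-isLinear : ∀ {k n} → IsLinear (λ (_ : Word F k) → 0ᵥ {n})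
  zero-isLinear = record
    { cong-≗ = λ _ _ → refl
    ; additive = λ _ _ _ → sym (+-identityʳ 0#)
    ; homogeneous = λ a _ _ → sym (zeroʳ a) }

  ∘-isLinear : ∀ {k m n} {f : Word F m → Word F n} {g : Word F k → Word F m} →
               IsLinear f → IsLinear g → IsLinear (f ∘ g)
  ∘-isLinear f-lin g-lin = record
    { cong-≗ = λ u≗v → cong-≗ f-lin (cong-≗ g-lin u≗v)
    ; additive = λ u v j → trans (cong-≗ f-lin (additive g-lin u v) j) (additive f-lin _ _ j)
    ; homogeneous = λ a u j →
        trans (cong-≗ f-lin (homogeneous g-lin a u) j) (homogeneous f-lin a _ j) }

  ⊖ᵥ-isLinear : ∀ {k n} {f g : Word F k → Word F n} →
                IsLinear f → IsLinear g → IsLinear (λ u → f u ⊖ᵥ g u)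
  ⊖ᵥ-isLinear f-lin g-lin = record
    { cong-≗ = λ u≗v j → cong₂ _⊖_ (cong-≗ f-lin u≗v j) (cong-≗ g-lin u≗v j)
    ; additive = λ u v j → trans (cong₂ _⊖_ (additive f-lin u v j) (additive g-lin u v j))
                                 (⊕-⊖-interchange _ _ _ _)
    ; homogeneous = λ a u j →
        trans (cong₂ _⊖_ (homogeneous f-lin a u j) (homogeneous g-lin a u j)) (sym (x[y-z]≈xy-xz a _ _)) }

  ++-isLinear : ∀ {k m n} {f : Word F k → Word F m} {g : Word F k → Word F n} →
                IsLinear f → IsLinear g → IsLinear (λ u → f u ++ g u)
  ++-isLinear {m = m} {f = f} {g} f-lin g-lin = record
    { cong-≗ = resp ; additive = add ; homogeneous = hom }
    where
    resp : ∀ {u v} → u ≗ v → (f u ++ g u) ≗ (f v ++ g v)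
    resp u≗v j with splitAt m j
    ... | inj₁ i = cong-≗ f-lin u≗v i
    ... | inj₂ i = cong-≗ g-lin u≗v i
    add : ∀ u v → (f (u ⊕ᵥ v) ++ g (u ⊕ᵥ v)) ≗ (f u ++ g u) ⊕ᵥ (f v ++ g v)
    add u v j with splitAt m j
    ... | inj₁ i = additive f-lin u v i
    ... | inj₂ i = additive g-lin u v i
    hom : ∀ a u → (f (a ⊗ᵥ u) ++ g (a ⊗ᵥ u)) ≗ a ⊗ᵥ (f u ++ g u)
    hom a u j with splitAt m j
    ... | inj₁ i = homogeneous f-lin a u i
    ... | inj₂ i = homogeneous g-lin a u i

  module _ {k n} {f : Word F k → Word F n} (f-lin : IsLinear f) where

    linear-zero : f 0ᵥ ≗ 0ᵥ
    linear-zero j = begin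
      f 0ᵥ j              ≡⟨ cong-≗ f-lin (λ _ → sym (zeroˡ 0#)) j ⟩
      f (0# ⊗ᵥ 0ᵥ) j      ≡⟨ homogeneous f-lin 0# 0ᵥ j ⟩
      0# ⊗ f 0ᵥ j         ≡⟨ zeroˡ _ ⟩
      0#                  ∎
      where open ≡-Reasoning

    linear-sub : ∀ u v → f (u ⊖ᵥ v) ≗ f u ⊖ᵥ f v
    linear-sub u v j = x≈z//y _ _ _ (begin
      f (u ⊖ᵥ v) j ⊕ f v j      ≡⟨ additive f-lin (u ⊖ᵥ v) v j ⟨
      f ((u ⊖ᵥ v) ⊕ᵥ v) j       ≡⟨ cong-≗ f-lin (λ i → //-rightDividesˡ (v i) (u i)) j ⟩
      f u j                     ∎)
      where open ≡-Reasoning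

    linear-sumF : ∀ {m} (g : Fin m → Word F k) →
                  f (λ l → sumF F m (λ i → g i l)) ≗ (λ j → sumF F m (λ i → f (g i) j))
    linear-sumF {zero} g = linear-zero
    linear-sumF {suc m} g j =
      trans (additive f-lin (g zero) _ j) (cong (f (g zero) j ⊕_) (linear-sumF (g ∘ suc) j))

  basis : ∀ {k} → Fin k → Word F k
  basis zero    zero    = 1#
  basis zero    (suc _) = 0#
  basis (suc _) zero    = 0#
  basis (suc i) (suc j) = basis i j

  sumF-cong : ∀ k {g h : Fin k → Carrier} → g ≗ h → sumF F k g ≡ sumF F k h
  sumF-cong zero    g≗h = refl
  sumF-cong (suc k) g≗h = cong₂ _⊕_ (g≗h zero) (sumF-cong k (g≗h ∘ suc))

  sumF-zero : ∀ k {g : Fin k → Carrier} → g ≗ (λ _ → 0#) → sumF F k g ≡ 0#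
  sumF-zero zero    g≗0 = refl
  sumF-zero (suc k) g≗0 = trans (cong₂ _⊕_ (g≗0 zero) (sumF-zero k (g≗0 ∘ suc))) (+-identityʳ 0#)

  basis-expansion : ∀ {k} (m : Word F k) → (λ l → sumF F k (λ i → m i ⊗ basis i l)) ≗ m
  basis-expansion {suc k} m zero = trans
    (cong₂ _⊕_ (*-identityʳ (m zero)) (sumF-zero k (λ i → zeroʳ (m (suc i)))))
    (+-identityʳ (m zero))
  basis-expansion {suc k} m (suc l) =
    trans (cong₂ _⊕_ (zeroʳ (m zero)) (basis-expansion (m ∘ suc) l)) (+-identityˡ (m (suc l)))

  encode-basis : ∀ {k n} {f : Word F k → Word F n} → IsLinear f →
                 ∀ m → encode F (λ i → f (basis i)) m ≗ f m
  encode-basis {k} {f = f} f-lin m j = begin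
    sumF F k (λ i → m i ⊗ f (basis i) j)          ≡⟨ sumF-cong k (λ i → homogeneous f-lin (m i) (basis i) j) ⟨
    sumF F k (λ i → f (m i ⊗ᵥ basis i) j)         ≡⟨ linear-sumF f-lin (λ i → m i ⊗ᵥ basis i) j ⟨
    f (λ l → sumF F k (λ i → m i ⊗ basis i l)) j  ≡⟨ cong-≗ f-lin (basis-expansion m) j ⟩
    f m j                                         ∎
    where open ≡-Reasoning

  -- Hamming weight

  wt₁ : Carrier → ℕ
  wt₁ x with x ≟ 0#
  ... | yes _ = 0
  ... | no  _ = 1

  wt₁-zero : ∀ {x} → x ≡ 0# → wt₁ x ≡ 0
  wt₁-zero {x} x≡0 with x ≟ 0#
  ... | yes _   = refl
  ... | no  x≢0 = ⊥-elim (x≢0 x≡0)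

  wt₁-nonzero : ∀ {x} → x ≢ 0# → wt₁ x ≡ 1
  wt₁-nonzero {x} x≢0 with x ≟ 0#
  ... | yes x≡0 = ⊥-elim (x≢0 x≡0)
  ... | no  _   = refl

  wt₁≤1 : ∀ x → wt₁ x ≤ 1
  wt₁≤1 x with x ≟ 0#
  ... | yes _ = z≤n
  ... | no  _ = s≤s z≤n

  wt₁-sub : ∀ x y → wt₁ (x ⊖ y) ≤ wt₁ x + wt₁ y
  wt₁-sub x y with x ≟ 0# | y ≟ 0#
  ... | yes x≡0 | yes y≡0 = ℕ.≤-reflexive (wt₁-zero (x≈y⇒x∙y⁻¹≈ε (trans x≡0 (sym y≡0))))
  ... | yes _   | no  _   = wt₁≤1 _
  ... | no  _   | yes _   = wt₁≤1 _
  ... | no  _   | no  _   = ℕ.≤-trans (wt₁≤1 _) (s≤s z≤n)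

  wt : (n : ℕ) → Word F n → ℕ
  wt zero    w = 0
  wt (suc n) w = wt₁ (w zero) + wt n (w ∘ suc)

  wt-cong : ∀ n {u v : Word F n} → u ≗ v → wt n u ≡ wt n v
  wt-cong zero    u≗v = refl
  wt-cong (suc n) u≗v = cong₂ _+_ (cong wt₁ (u≗v zero)) (wt-cong n (u≗v ∘ suc))

  wt-zero : ∀ n {u : Word F n} → u ≗ 0ᵥ → wt n u ≡ 0
  wt-zero zero    u≗0 = refl
  wt-zero (suc n) u≗0 = cong₂ _+_ (wt₁-zero (u≗0 zero)) (wt-zero n (u≗0 ∘ suc))

  wt-sub : ∀ n (u v : Word F n) → wt n (u ⊖ᵥ v) ≤ wt n u + wt n v
  wt-sub zero    u v = z≤n
  wt-sub (suc n) u v = ℕ.≤-trans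
    (ℕ.+-mono-≤ (wt₁-sub (u zero) (v zero)) (wt-sub n (u ∘ suc) (v ∘ suc)))
    (ℕ.≤-reflexive (+-interchange (wt₁ (u zero)) (wt₁ (v zero)) _ _))

  wt-++ : ∀ m {n} (u : Word F m) (v : Word F n) → wt (m + n) (u ++ v) ≡ wt m u + wt n v
  wt-++ zero    u v = refl
  wt-++ (suc m) {n} u v = begin
    w₀ + wt (m + n) ((u ++ v) ∘ suc)    ≡⟨ cong (w₀ +_) (wt-cong (m + n) ([,]-map ∘ splitAt m)) ⟩
    w₀ + wt (m + n) ((u ∘ suc) ++ v)    ≡⟨ cong (w₀ +_) (wt-++ m (u ∘ suc) v) ⟩
    w₀ + (wt m (u ∘ suc) + wt n v)      ≡⟨ ℕ.+-assoc w₀ _ _ ⟨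
    wt (suc m) u + wt n v               ∎
    where
    open ≡-Reasoning
    w₀ = wt₁ (u zero)

  dist≡wt : ∀ n (c c' : Word F n) → dist F n c c' ≡ wt n (c ⊖ᵥ c')
  dist≡wt zero    c c' = refl
  dist≡wt (suc n) c c' with c zero ≟ c' zero
  ... | yes c₀≡c₀' rewrite wt₁-zero (x≈y⇒x∙y⁻¹≈ε c₀≡c₀') =
    dist≡wt n (c ∘ suc) (c' ∘ suc)
  ... | no  c₀≢c₀' rewrite wt₁-nonzero (c₀≢c₀' ∘ x∙y⁻¹≈ε⇒x≈y _ _) =
    cong suc (dist≡wt n (c ∘ suc) (c' ∘ suc))

  parity : Word F 2 → Word F 3
  parity s 0F = s 0F
  parity s 1F = s 1F
  parity s 2F = s 0F ⊕ s 1F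

  parity-isLinear : IsLinear parity
  parity-isLinear = record { cong-≗ = resp ; additive = add ; homogeneous = hom }
    where
    resp : ∀ {u v} → u ≗ v → parity u ≗ parity v
    resp u≗v 0F = u≗v 0F
    resp u≗v 1F = u≗v 1F
    resp u≗v 2F = cong₂ _⊕_ (u≗v 0F) (u≗v 1F)
    add : ∀ u v → parity (u ⊕ᵥ v) ≗ parity u ⊕ᵥ parity v
    add u v 0F = refl
    add u v 1F = refl
    add u v 2F = ⊕-interchange (u 0F) (v 0F) (u 1F) (v 1F)
    hom : ∀ a u → parity (a ⊗ᵥ u) ≗ a ⊗ᵥ parity u
    hom a u 0F = refl
    hom a u 1F = refl
    hom a u 2F = sym (distribˡ a (u 0F) (u 1F))

  parityWeight : Word F 2 → ℕ
  parityWeight s = wt 3 (parity s)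

  parityWeight-cong : ∀ {s s'} → s ≗ s' → parityWeight s ≡ parityWeight s'
  parityWeight-cong s≗s' = wt-cong 3 (cong-≗ parity-isLinear s≗s')

  parityWeight-zero : ∀ {s} → s ≗ 0ᵥ → parityWeight s ≡ 0
  parityWeight-zero s≗0 =
    wt-zero 3 (λ j → trans (cong-≗ parity-isLinear s≗0 j) (linear-zero parity-isLinear j))

  parityWeight-sub : ∀ s p → parityWeight (s ⊖ᵥ p) ≤ parityWeight s + parityWeight p
  parityWeight-sub s p = ℕ.≤-trans
    (ℕ.≤-reflexive (wt-cong 3 (linear-sub parity-isLinear s p)))
    (wt-sub 3 (parity s) (parity p))

  parityWeight-zero⊎≥2 : ∀ s → s ≗ 0ᵥ ⊎ 2 ≤ parityWeight s
  parityWeight-zero⊎≥2 s with s 0F ≟ 0# | s 1F ≟ 0#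
  ... | yes s₀≡0 | yes s₁≡0 = inj₁ λ { 0F → s₀≡0 ; 1F → s₁≡0 }
  ... | no  s₀≢0 | no  s₁≢0 = inj₂ (s≤s (s≤s z≤n))
  ... | no  s₀≢0 | yes s₁≡0
    rewrite wt₁-nonzero (s₀≢0 ∘ trans (sym (trans (cong (s 0F ⊕_) s₁≡0) (+-identityʳ _))))
    = inj₂ (s≤s (s≤s z≤n))
  ... | yes s₀≡0 | no  s₁≢0
    rewrite wt₁-nonzero (s₁≢0 ∘ trans (sym (trans (cong (_⊕ s 1F) s₀≡0) (+-identityˡ _))))
    = inj₂ (s≤s (s≤s z≤n))

  -- Locality

  Recovers : ∀ {A : Set} {n} → (A → Word F n) → Fin n → Subset n → Set
  Recovers f i S = ∀ a a' → (∀ j → j ∈ S → f a j ≡ f a' j) → f a i ≡ f a' i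

  LocallyRecoverable : ∀ {A : Set} {n} → ℕ → (A → Word F n) → Set
  LocallyRecoverable {n = n} r f =
    (i : Fin n) → Σ (Subset n) λ S → i ∉ S × ∣ S ∣ ≤ r × Recovers f i S

  locality-transfer : ∀ {A B : Set} {n r} {f : A → Word F n} {g : B → Word F n} (h : B → A) →
                      (∀ b → g b ≗ f (h b)) → LocallyRecoverable r f → LocallyRecoverable r g
  locality-transfer {f = f} {g} h g≗f∘h loc i with loc i
  ... | S , i∉S , ∣S∣≤r , recover = S , i∉S , ∣S∣≤r , recover′
    where
    recover′ : Recovers g i S
    recover′ b b' agree = begin
      g b i         ≡⟨ g≗f∘h b i ⟩
      f (h b) i     ≡⟨ recover (h b) (h b') agree′ ⟩
      f (h b') i    ≡⟨ g≗f∘h b' i ⟨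
      g b' i        ∎
      where
      open ≡-Reasoning
      agree′ : ∀ j → j ∈ S → f (h b) j ≡ f (h b') j
      agree′ j j∈S = trans (sym (g≗f∘h b j)) (trans (agree j j∈S) (g≗f∘h b' j))

  locality-repetition₂ : ∀ {A : Set} (x : A → Carrier) → LocallyRecoverable 2 (λ a (_ : Fin 2) → x a)
  locality-repetition₂ x 0F =
    (outside ∷ inside ∷ []) , (λ ()) , s≤s z≤n , λ a a' agree → agree 1F (there here)
  locality-repetition₂ x 1F =
    (inside ∷ outside ∷ []) , (λ { (there ()) }) , s≤s z≤n , λ a a' agree → agree 0F here

  locality-parity-++ : ∀ {A : Set} {n} (p : A → Word F 2) (g : A → Word F n) →
                       LocallyRecoverable 2 g → LocallyRecoverable 2 (λ a → parity (p a) ++ g a)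
  locality-parity-++ {n = n} p g loc 0F =
    (outside ∷ inside ∷ inside ∷ ⊥) , (λ ()) , ℕ.≤-reflexive (cong (2 +_) (∣⊥∣≡0 n)) ,
    λ a a' agree → +-cancelʳ (p a 1F) _ _
      (trans (agree 2F (there (there here))) (cong (p a' 0F ⊕_) (sym (agree 1F (there here)))))
  locality-parity-++ {n = n} p g loc 1F =
    (inside ∷ outside ∷ inside ∷ ⊥) , (λ { (there ()) }) , ℕ.≤-reflexive (cong (2 +_) (∣⊥∣≡0 n)) ,
    λ a a' agree → +-cancelˡ (p a 0F) _ _
      (trans (agree 2F (there (there here))) (cong (_⊕ p a' 1F) (sym (agree 0F here))))
  locality-parity-++ {n = n} p g loc 2F =
    (inside ∷ inside ∷ outside ∷ ⊥) , (λ { (there (there ())) }) , ℕ.≤-reflexive (cong (2 +_) (∣⊥∣≡0 n)) ,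
    λ a a' agree → cong₂ _⊕_ (agree 0F here) (agree 1F (there here))
  locality-parity-++ p g loc (suc (suc (suc i))) with loc i
  ... | S , i∉S , ∣S∣≤2 , recover =
    (outside ∷ outside ∷ outside ∷ S) , (λ { (there (there (there i∈S))) → i∉S i∈S }) , ∣S∣≤2 ,
    λ a a' agree → recover a a' λ j j∈S → agree (suc (suc (suc j))) (there (there (there j∈S)))

  -- Syndrome codes

  -- A message of a syndrome code is a syndrome s ∈ F², the prescribed sum of the information pairs,
  -- followed by the information symbols.
  syndrome : ∀ {k} → Word F (2 + k) → Word F 2
  syndrome = take 2

  message : ∀ {k} → Word F (2 + k) → Word F k
  message = drop 2

  syndrome-isLinear : ∀ {k} → IsLinear (syndrome {k})
  syndrome-isLinear {k} = reindex-isLinear (_↑ˡ k)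

  message-isLinear : ∀ {k} → IsLinear (message {k})
  message-isLinear = reindex-isLinear (2 ↑ʳ_)

  -- Counting the parity block of the syndrome is what makes this bound survive prependBlock;
  -- at syndrome 0 it is minimum distance 4.
  Heavy : ∀ {k n} → (Word F (2 + k) → Word F n) → Set
  Heavy {n = n} f = ∀ u → u ≗ 0ᵥ ⊎ 4 ≤ parityWeight (syndrome u) + wt n (f u)

  record SyndromeCode (k n : ℕ) : Set where
    field
      code : Word F (2 + k) → Word F n
      isLinear : IsLinear code
      heavy : Heavy code
      locality : LocallyRecoverable 2 code

  parityBlock : SyndromeCode 0 3
  parityBlock = record
    { code = parity ∘ syndrome
    ; isLinear = ∘-isLinear parity-isLinear syndrome-isLinear
    ; heavy = heavy
    ; locality = locality-transfer id
        (λ _ → λ { 0F → refl ; 1F → refl ; 2F → refl ; (suc (suc (suc ()))) })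
        (locality-parity-++ syndrome (λ _ ()) (λ ()))
    }
    where
    heavy : Heavy (parity ∘ syndrome)
    heavy u with parityWeight-zero⊎≥2 (syndrome u)
    ... | inj₁ s≗0 = inj₁ λ { 0F → s≗0 0F ; 1F → s≗0 1F ; (suc (suc ())) }
    ... | inj₂ 2≤w = inj₂ (ℕ.+-mono-≤ 2≤w 2≤w)

  parityRepetitionBlock : SyndromeCode 1 5
  parityRepetitionBlock = record
    { code = code
    ; isLinear = ++-isLinear
        (∘-isLinear parity-isLinear
          (⊖ᵥ-isLinear syndrome-isLinear (++-isLinear message-isLinear zero-isLinear)))
        (reindex-isLinear (λ _ → 2F))
    ; heavy = heavy
    ; locality = locality-parity-++ (λ u → syndrome u ⊖ᵥ shift u) repeated
                   (locality-repetition₂ (λ u → u 2F))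
    }
    where
    shift : Word F 3 → Word F 2
    shift u = message u ++ 0ᵥ

    repeated : Word F 3 → Word F 2
    repeated u _ = u 2F

    code : Word F 3 → Word F 5
    code u = parity (syndrome u ⊖ᵥ shift u) ++ repeated u

    wt-code : ∀ u → wt 5 (code u) ≡ parityWeight (syndrome u ⊖ᵥ shift u) + wt 2 (repeated u)
    wt-code u = wt-++ 3 (parity (syndrome u ⊖ᵥ shift u)) (repeated u)

    heavy : Heavy code
    heavy u with toSum (u 2F ≟ 0#)
    ... | inj₂ c≢0 = inj₂ (begin
      4                                            ≤⟨ ℕ.+-mono-≤ 2≤pw+pw′ 2≤wt ⟩
      (parityWeight s + parityWeight s′) + wt 2 cc ≡⟨ ℕ.+-assoc (parityWeight s) _ _ ⟩
      parityWeight s + (parityWeight s′ + wt 2 cc) ≡⟨ cong (parityWeight s +_) (wt-code u) ⟨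
      parityWeight s + wt 5 (code u)               ∎)
      where
      open ℕ.≤-Reasoning
      s = syndrome u
      s′ = s ⊖ᵥ shift u
      cc = repeated u
      2≤wt : 2 ≤ wt 2 cc
      2≤wt rewrite wt₁-nonzero c≢0 = ℕ.≤-refl
      -- s and s′ differ by (c , 0) ≠ 0, so one of their parity blocks is nonzero
      2≤pw+pw′ : 2 ≤ parityWeight s + parityWeight s′
      2≤pw+pw′ with parityWeight-zero⊎≥2 (s ⊖ᵥ s′)
      ... | inj₁ s⊖s′≗0 = ⊥-elim (c≢0 (trans (sym (x⊖[x⊖y]≡y (u 0F) (u 2F))) (s⊖s′≗0 0F)))
      ... | inj₂ 2≤w = ℕ.≤-trans 2≤w (parityWeight-sub s s′)
    ... | inj₁ c≡0 with parityWeight-zero⊎≥2 (syndrome u)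
    ...   | inj₁ s≗0 = inj₁ λ { 0F → s≗0 0F ; 1F → s≗0 1F ; 2F → c≡0 }
    ...   | inj₂ 2≤w = inj₂ (begin
      4                                            ≤⟨ ℕ.+-mono-≤ 2≤w (ℕ.≤-trans 2≤w (ℕ.m≤m+n _ 0)) ⟩
      parityWeight s + (parityWeight s + 0)        ≡⟨ cong (parityWeight s +_) (cong₂ _+_ pw′≡pw wt≡0) ⟨
      parityWeight s + (parityWeight s′ + wt 2 cc) ≡⟨ cong (parityWeight s +_) (wt-code u) ⟨
      parityWeight s + wt 5 (code u)               ∎)
      where
      open ℕ.≤-Reasoning
      s = syndrome u
      s′ = s ⊖ᵥ shift u
      cc = repeated u
      pw′≡pw : parityWeight s′ ≡ parityWeight s
      pw′≡pw = parityWeight-cong {s′} {s} λ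
        { 0F → trans (cong (u 0F ⊖_) c≡0) (x⊖0≡x (u 0F)) ; 1F → x⊖0≡x (u 1F) }
      wt≡0 : wt 2 cc ≡ 0
      wt≡0 = wt-zero 2 (λ _ → c≡0)

  residual : ∀ {k} → Word F (2 + (2 + k)) → Word F (2 + k)
  residual u = (syndrome u ⊖ᵥ syndrome (message u)) ++ message (message u)

  residual-isLinear : ∀ {k} → IsLinear (residual {k})
  residual-isLinear = ++-isLinear
    (⊖ᵥ-isLinear syndrome-isLinear (∘-isLinear syndrome-isLinear message-isLinear))
    (∘-isLinear message-isLinear message-isLinear)

  prependBlock : ∀ {k n} → SyndromeCode k n → SyndromeCode (2 + k) (3 + n)
  prependBlock {k} {n} C = record
    { code = code′
    ; isLinear = ++-isLinear
        (∘-isLinear parity-isLinear (∘-isLinear syndrome-isLinear message-isLinear))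
        (∘-isLinear isLinear residual-isLinear)
    ; heavy = heavy′
    ; locality = locality-parity-++ (syndrome ∘ message) (code ∘ residual)
                   (locality-transfer residual (λ _ _ → refl) locality)
    }
    where
    open SyndromeCode C

    code′ : Word F (2 + (2 + k)) → Word F (3 + n)
    code′ u = parity (syndrome (message u)) ++ code (residual u)

    wt-code′ : ∀ u →
      wt (3 + n) (code′ u) ≡ parityWeight (syndrome (message u)) + wt n (code (residual u))
    wt-code′ u = wt-++ 3 (parity (syndrome (message u))) (code (residual u))

    heavy′ : Heavy code′
    heavy′ u with heavy (residual u)
    ... | inj₂ 4≤w = inj₂ (begin
      4                                     ≤⟨ 4≤w ⟩
      parityWeight (s ⊖ᵥ p) + W             ≤⟨ ℕ.+-monoˡ-≤ W (parityWeight-sub s p) ⟩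
      (parityWeight s + parityWeight p) + W ≡⟨ ℕ.+-assoc (parityWeight s) _ _ ⟩
      parityWeight s + (parityWeight p + W) ≡⟨ cong (parityWeight s +_) (wt-code′ u) ⟨
      parityWeight s + wt (3 + n) (code′ u) ∎)
      where
      open ℕ.≤-Reasoning
      s = syndrome u
      p = syndrome (message u)
      W = wt n (code (residual u))
    ... | inj₁ r≗0 with parityWeight-zero⊎≥2 (syndrome (message u))
    ...   | inj₁ p≗0 = inj₁ λ
      { 0F → trans (x∙y⁻¹≈ε⇒x≈y _ _ (r≗0 0F)) (p≗0 0F)
      ; 1F → trans (x∙y⁻¹≈ε⇒x≈y _ _ (r≗0 1F)) (p≗0 1F)
      ; 2F → p≗0 0F
      ; 3F → p≗0 1F
      ; (suc (suc (suc (suc i)))) → r≗0 (suc (suc i))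
      }
    ...   | inj₂ 2≤pw = inj₂ (begin
      4                                     ≤⟨ ℕ.+-mono-≤ 2≤pw (ℕ.≤-trans 2≤pw (ℕ.m≤m+n _ W)) ⟩
      parityWeight p + (parityWeight p + W) ≡⟨ cong (_+ (parityWeight p + W)) pw-s≡pw-p ⟨
      parityWeight s + (parityWeight p + W) ≡⟨ cong (parityWeight s +_) (wt-code′ u) ⟨
      parityWeight s + wt (3 + n) (code′ u) ∎)
      where
      open ℕ.≤-Reasoning
      s = syndrome u
      p = syndrome (message u)
      W = wt n (code (residual u))
      pw-s≡pw-p : parityWeight s ≡ parityWeight p
      pw-s≡pw-p = parityWeight-cong {s} {p} λ
        { 0F → x∙y⁻¹≈ε⇒x≈y _ _ (r≗0 0F) ; 1F → x∙y⁻¹≈ε⇒x≈y _ _ (r≗0 1F) }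

  prependBlocks : ∀ {k n} (t : ℕ) → SyndromeCode k n → SyndromeCode (2 * t + k) (3 * t + n)
  prependBlocks zero    C = C
  prependBlocks {k} {n} (suc t) C =
    subst₂ SyndromeCode (cong (_+ k) (sym (ℕ.*-suc 2 t))) (cong (_+ n) (sym (ℕ.*-suc 3 t)))
      (prependBlock (prependBlocks t C))

  module _ {k n} (C : SyndromeCode k n) where
    open SyndromeCode C

    withZeroSyndrome : Word F k → Word F (2 + k)
    withZeroSyndrome m = 0ᵥ ++ m

    code₀ : Word F k → Word F n
    code₀ = code ∘ withZeroSyndrome

    code₀-isLinear : IsLinear code₀
    code₀-isLinear = ∘-isLinear isLinear (++-isLinear zero-isLinear (reindex-isLinear id))

    code₀-zero⊎≥4 : ∀ m → m ≗ 0ᵥ ⊎ 4 ≤ wt n (code₀ m)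
    code₀-zero⊎≥4 m with heavy (withZeroSyndrome m)
    ... | inj₁ u≗0 = inj₁ (u≗0 ∘ (2 ↑ʳ_))
    ... | inj₂ 4≤w =
      inj₂ (subst (λ w → 4 ≤ w + wt n (code₀ m)) (parityWeight-zero {0ᵥ} λ _ → refl) 4≤w)

    generator : Fin k → Fin n → Carrier
    generator i = code₀ (basis i)

    encode-generator : ∀ m → encode F generator m ≗ code₀ m
    encode-generator = encode-basis code₀-isLinear

    generator-isLRC : IsLRC F n k 4 2 generator
    generator-isLRC = fullRank , minDist , locality-transfer withZeroSyndrome encode-generator locality
      where
      fullRank : IsFullRank F generator
      fullRank m encode≗0 with code₀-zero⊎≥4 m
      ... | inj₁ m≗0 = m≗0
      ... | inj₂ 4≤w = ⊥-elim (ℕ.n≮0 (subst (4 ≤_) (wt-zero n code₀≗0) 4≤w))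
        where
        code₀≗0 : code₀ m ≗ 0ᵥ
        code₀≗0 j = trans (sym (encode-generator m j)) (encode≗0 j)

      minDist : MinDistAtLeast F generator 4
      minDist m m' (j , differ) with code₀-zero⊎≥4 (m ⊖ᵥ m')
      ... | inj₁ m⊖m'≗0 = ⊥-elim (differ (begin
        encode F generator m j    ≡⟨ encode-generator m j ⟩
        code₀ m j                 ≡⟨ cong-≗ code₀-isLinear (λ i → x∙y⁻¹≈ε⇒x≈y _ _ (m⊖m'≗0 i)) j ⟩
        code₀ m' j                ≡⟨ encode-generator m' j ⟨
        encode F generator m' j   ∎))
        where open ≡-Reasoning
      ... | inj₂ 4≤w = subst (4 ≤_) (sym dist≡) 4≤w
        where
        dist≡ : dist F n (encode F generator m) (encode F generator m') ≡ wt n (code₀ (m ⊖ᵥ m'))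
        dist≡ = trans (dist≡wt n _ _) (wt-cong n λ l → trans
          (cong₂ _⊖_ (encode-generator m l) (encode-generator m' l))
          (sym (linear-sub code₀-isLinear m m' l)))

    syndromeCode⇒nLRC≤ : nLRC≤ F k 4 2 n
    syndromeCode⇒nLRC≤ = n , ℕ.≤-refl , generator , generator-isLRC

lemma32 : (F : FiniteField) → (t : ℕ) → 2 ≤ t →
    nLRC≤ F (2 * t) 4 2 (3 * t + 3) × (FiniteField.size F ≡ 2 → nLRC≤ F (2 * t + 1) 4 2 (3 * t + 5))
lemma32 F t _ =
  subst (λ k → nLRC≤ F k 4 2 (3 * t + 3)) (ℕ.+-identityʳ (2 * t))
        (syndromeCode⇒nLRC≤ F (prependBlocks F t (parityBlock F))) ,
  λ _ → syndromeCode⇒nLRC≤ F (prependBlocks F t (parityRepetitionBlock F))
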